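{- For every graph $G$, $\mathrm{ThrWidth}(G)\le 2$ if and only if $G$ or $\overline{G}$ is a threshold graph or a difference graph.
   Context: Graphs are finite, simple, undirected; digraphs may have loops but no multiple arcs. An $n$-partitioned graph is $(G,A_1,\dots,A_n)$ with $(A_1,\dots,A_n)$ a partition of $V(G)$ (parts may be empty). For a digraph $H$ on $\{1,\dots,n\}$, $(G,A_1,\dots,A_n)\circ_H(F,B_1,\dots,B_n)=(R,A_1\cup B_1,\dots,A_n\cup B_n)$ where $V(R)=V(G)\cup V(F)$ (disjoint union) and $E(R)=E(G)\cup E(F)\cup\{xy:x\in A_i,y\in B_j,(i,j)\in A(H)\}$. $K^k_i$ denotes the $k$-partitioned graph with one vertex lying in the $i$-th part. A graph $G$ is $H$-threshold if it is the underlying graph of $K^k_{i_1}\circ_H\cdots\circ_H K^k_{i_m}$ for some $i_1,\dots,i_m$ (distinct vertices), $H$ a digraph on $\{1,\dots,k\}$. $\mathrm{ThrWidth}(G)$ is the minimum number of vertices of a digraph $H$ such that $G$ is $H$-threshold. A threshold graph is a graph with no induced subgraph isomorphic to $2K_2$, $C_4$ or $P_4$. A difference graph is a graph $G$ whose vertex set has a partition $(A,B)$ into two independent sets (possibly empty) such that the sets $\{N_A(b):b\in B\}$ are totally ordered by inclusion and the sets $\{N_B(a):a\in A\}$ are totally ordered by inclusion, where $N_X(x)=\{y\in X: xy\in E(G)\}$. -}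

module Defs where

open import Data.Nat using (ℕ; zero; suc; _+_; _≤_)
open import Data.Fin using (Fin; zero; suc; splitAt; _≟_)
open import Data.Bool using (Bool; true; false; not; _∧_)
open import Data.Sum using (_⊎_; inj₁; inj₂)
open import Data.Product using (Σ; ∃; _×_; _,_)
open import Data.List using (List; []; _∷_; foldr)
open import Data.Empty using (⊥)
open import Function.Bundles using (_↔_; Inverse)
open import Relation.Nullary using (¬_; yes; no)
open import Relation.Binary.PropositionalEquality using (_≡_; refl; sym)

record Graph : Set where
  field
    n      : ℕ
    adj    : Fin n → Fin n → Bool
    adj-sym : ∀ x y → adj x y ≡ adj y x
    adj-irrefl : ∀ x → adj x x ≡ false
open Graph public

private
  eqb : ∀ {n} → Fin n → Fin n → Bool
  eqb x y with x ≟ y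
  ... | yes _ = true
  ... | no _ = false

  eqb-sym : ∀ {n} (x y : Fin n) → eqb x y ≡ eqb y x
  eqb-sym x y with x ≟ y | y ≟ x
  ... | yes _ | yes _ = refl
  ... | no _ | no _ = refl
  ... | yes p | no q with q (sym p)
  ... | ()
  eqb-sym x y | no q | yes p with q (sym p)
  ... | ()

  eqb-refl : ∀ {n} (x : Fin n) → eqb x x ≡ true
  eqb-refl x with x ≟ x
  ... | yes _ = refl
  ... | no q with q refl
  ... | ()

compl : Graph → Graph
compl G = record
  { n = n G
  ; adj = λ x y → not (eqb x y) ∧ not (adj G x y)
  ; adj-sym = λ x y → helper x y
  ; adj-irrefl = λ x → helper2 x
  }
  where
  helper : ∀ x y → (not (eqb x y) ∧ not (adj G x y)) ≡ (not (eqb y x) ∧ not (adj G y x))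
  helper x y rewrite eqb-sym x y | Graph.adj-sym G x y = refl
  helper2 : ∀ x → (not (eqb x x) ∧ not (adj G x x)) ≡ false
  helper2 x rewrite eqb-refl x = refl

HasInduced4 : Graph → (Fin 4 → Fin 4 → Bool) → Set
HasInduced4 G F =
  Σ (Fin 4 → Fin (n G)) λ f →
    (∀ a b → f a ≡ f b → a ≡ b) × (∀ a b → adj G (f a) (f b) ≡ F a b)

twoK2 : Fin 4 → Fin 4 → Bool
twoK2 zero (suc zero) = true
twoK2 (suc zero) zero = true
twoK2 (suc (suc zero)) (suc (suc (suc zero))) = true
twoK2 (suc (suc (suc zero))) (suc (suc zero)) = true
twoK2 _ _ = false

C4 : Fin 4 → Fin 4 → Bool
C4 zero (suc zero) = true
C4 (suc zero) zero = true
C4 (suc zero) (suc (suc zero)) = true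
C4 (suc (suc zero)) (suc zero) = true
C4 (suc (suc zero)) (suc (suc (suc zero))) = true
C4 (suc (suc (suc zero))) (suc (suc zero)) = true
C4 (suc (suc (suc zero))) zero = true
C4 zero (suc (suc (suc zero))) = true
C4 _ _ = false

P4 : Fin 4 → Fin 4 → Bool
P4 zero (suc zero) = true
P4 (suc zero) zero = true
P4 (suc zero) (suc (suc zero)) = true
P4 (suc (suc zero)) (suc zero) = true
P4 (suc (suc zero)) (suc (suc (suc zero))) = true
P4 (suc (suc (suc zero))) (suc (suc zero)) = true
P4 _ _ = false

IsThreshold : Graph → Set
IsThreshold G = ¬ HasInduced4 G twoK2 × ¬ HasInduced4 G C4 × ¬ HasInduced4 G P4

-- Difference graphs.  A partition (A,B) of V(G) is encoded by
-- side : Fin n → Bool, with A = side⁻¹(true), B = side⁻¹(false).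

IsDifference : Graph → Set
IsDifference G =
  Σ (Fin (n G) → Bool) λ side →
    (∀ x y → side x ≡ side y → adj G x y ≡ false)
    × (∀ b b' → side b ≡ false → side b' ≡ false →
         (∀ a → side a ≡ true → adj G b a ≡ true → adj G b' a ≡ true)
         ⊎ (∀ a → side a ≡ true → adj G b' a ≡ true → adj G b a ≡ true))
    × (∀ a a' → side a ≡ true → side a' ≡ true →
         (∀ b → side b ≡ false → adj G a b ≡ true → adj G a' b ≡ true)
         ⊎ (∀ b → side b ≡ false → adj G a' b ≡ true → adj G a b ≡ true))

Digraph : ℕ → Set
Digraph k = Fin k → Fin k → Bool   -- arc relation; loops allowed

record PGraph (k : ℕ) : Set where
  field
    size : ℕ
    padj : Fin size → Fin size → Bool
    part : Fin size → Fin k          -- vertex x lies in A_(part x)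
open PGraph public

compose : ∀ {k} → Digraph k → PGraph k → PGraph k → PGraph k
compose {k} H G F = record
  { size = size G + size F
  ; padj = e
  ; part = p
  }
  where
  p : Fin (size G + size F) → Fin k
  p z with splitAt (size G) z
  ... | inj₁ x = part G x
  ... | inj₂ y = part F y
  e : Fin (size G + size F) → Fin (size G + size F) → Bool
  e u v with splitAt (size G) u | splitAt (size G) v
  ... | inj₁ x | inj₁ x' = padj G x x'
  ... | inj₂ y | inj₂ y' = padj F y y'
  ... | inj₁ x | inj₂ y  = H (part G x) (part F y)
  ... | inj₂ y | inj₁ x  = H (part G x) (part F y)

K : ∀ {k} → Fin k → PGraph k
K i = record { size = 1 ; padj = λ _ _ → false ; part = λ _ → i }

emptyP : ∀ {k} → PGraph k
emptyP = record { size = 0 ; padj = λ () ; part = λ () }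

-- K_{i₁} ∘_H (K_{i₂} ∘_H (… ∘_H K_{iₘ}))   (∘_H is associative)
composeAll : ∀ {k} → Digraph k → List (Fin k) → PGraph k
composeAll H is = foldr (λ i P → compose H (K i) P) emptyP is

IsoUnderlying : ∀ {k} → PGraph k → Graph → Set
IsoUnderlying P G =
  Σ (Fin (size P) ↔ Fin (n G)) λ f →
    ∀ x y → adj G (Inverse.to f x) (Inverse.to f y) ≡ padj P x y

IsHThreshold : ∀ {k} → Digraph k → Graph → Set
IsHThreshold H G = Σ (List _) λ is → IsoUnderlying (composeAll H is) G

ThrWidth≤ : Graph → ℕ → Set
ThrWidth≤ G m = Σ ℕ λ k → k ≤ m × Σ (Digraph k) λ H → IsHThreshold H G

module Submission where

-- Both directions go through layouts: an injective ranking of the vertices,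
-- with labels in Fin 2, such that an earlier u and a later v are adjacent iff
-- the digraph H on {0,1} has the arc (lab u, lab v).  Reading
-- K_{i₁} ∘_H ⋯ ∘_H K_{iₙ} in composition order gives a layout; conversely a
-- layout is realised by peeling its vertices in order (realise-by-peeling).
--
-- (⇒) A layout over H is classified by the loops of H.  With no loop the two
--     label classes are the sides of a difference graph (rank-difference);
--     with one loop every four vertices contain one adjacent to all or none of
--     the other three, which excludes 2K₂, C₄ and P₄; with two loops the
--     complement has a loop-free layout.
-- (⇐) A threshold graph has a dominating or an isolated vertex (a top of the
--     vicinal preorder, which is total because 2K₂, C₄, P₄ are excluded), and a
--     difference graph has a vertex joined to all or none of the opposite side;
--     peeling such vertices realises them over H_T and H_D.  For complements,
--     the layout of the realisation is negated and realised again.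

open import Defs
open import Data.Bool using (Bool; true; false; not; _∧_; if_then_else_)
import Data.Bool.Properties as Boolₚ
open import Data.Empty using (⊥; ⊥-elim)
open import Data.Fin using (Fin; zero; suc; punchIn; toℕ; opposite)
open import Data.Fin.Patterns using (0F; 1F; 2F; 3F)
open import Data.Fin.Permutation using (insert)
open import Data.Fin.Properties using (_≟_; all?; any?; punchIn-injective; punchInᵢ≢i; ¬Fin0; toℕ-injective; opposite-involutive)
open import Data.List using (List; []; _∷_)
open import Data.Nat using (ℕ; zero; suc; _≤_; _<_; z≤n; s≤s)
open import Data.Nat.Properties using (≤-refl; ≤-total; ≤-trans; ≤∧≢⇒<; <-cmp; <-irrefl; <-asym; <-≤-trans; ≤-<-trans)
open import Data.Product using (Σ; ∃; _×_; _,_; proj₁; proj₂)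
open import Data.Sum using (_⊎_; inj₁; inj₂; [_,_]′)
import Data.Sum as Sum
open import Data.Vec using ([]; _∷_; lookup)
open import Function using (_∘′_)
open import Function.Bundles using (_↔_; Inverse; _⇔_; Equivalence; mk⇔)
open import Function.Construct.Identity using (↔-id)
open import Relation.Binary.Definitions using (tri<; tri≈; tri>)
open import Relation.Binary.PropositionalEquality using (_≡_; _≢_; refl; sym; trans; cong; cong₂; module ≡-Reasoning)
open import Relation.Nullary using (¬_; Dec; yes; no)
open import Relation.Nullary.Decidable using (True; toWitness; ¬?; _×-dec_; _→-dec_)

Adj : ℕ → Set
Adj m = Fin m → Fin m → Bool

Sym : ∀ {m} → Adj m → Set
Sym ad = ∀ x y → ad x y ≡ ad y x

Irrefl : ∀ {m} → Adj m → Set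
Irrefl ad = ∀ x → ad x x ≡ false

delete : ∀ {m} → Adj (suc m) → Fin (suc m) → Adj m
delete ad v x y = ad (punchIn v x) (punchIn v y)

Pattern : Set
Pattern = Fin 4 → Fin 4 → Bool

-- Raw-adjacency versions of the notions of Defs; IsThreshold G and
-- IsDifference G are definitionally Threshold (adj G) and Difference (adj G).
Induced : ∀ {m} → Adj m → Pattern → Set
Induced {m} ad F =
  Σ (Fin 4 → Fin m) λ g → (∀ a b → g a ≡ g b → a ≡ b) × (∀ a b → ad (g a) (g b) ≡ F a b)

Threshold : ∀ {m} → Adj m → Set
Threshold ad = ¬ Induced ad twoK2 × ¬ Induced ad C4 × ¬ Induced ad P4

DifferenceBy : ∀ {m} → Adj m → (Fin m → Bool) → Set
DifferenceBy ad side =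
    (∀ x y → side x ≡ side y → ad x y ≡ false)
    × (∀ b b' → side b ≡ false → side b' ≡ false →
         (∀ a → side a ≡ true → ad b a ≡ true → ad b' a ≡ true)
         ⊎ (∀ a → side a ≡ true → ad b' a ≡ true → ad b a ≡ true))
    × (∀ a a' → side a ≡ true → side a' ≡ true →
         (∀ b → side b ≡ false → ad a b ≡ true → ad a' b ≡ true)
         ⊎ (∀ b → side b ≡ false → ad a' b ≡ true → ad a b ≡ true))

Difference : ∀ {m} → Adj m → Set
Difference ad = Σ _ (DifferenceBy ad)

least-element : ∀ {n} (R : Fin (suc n) → Fin (suc n) → Set) →
  (∀ u v → R u v ⊎ R v u) → (∀ {u v w} → R u v → R v w → R u w) →
  Σ (Fin (suc n)) λ a → ∀ b → R a b
least-element {zero} R total trans′ = zero , λ { zero → Sum.reduce (total zero zero) }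
least-element {suc n} R total trans′ with least-element (λ u v → R (suc u) (suc v)) (λ u v → total (suc u) (suc v)) trans′
... | a , a-least with total zero (suc a)
...   | inj₁ 0≤a = zero , λ { zero → Sum.reduce (total zero zero) ; (suc b) → trans′ 0≤a (a-least b) }
...   | inj₂ a≤0 = suc a , λ { zero → a≤0 ; (suc b) → a-least b }

true-and-false : ∀ {b} → b ≡ true → b ≡ false → ⊥
true-and-false refl ()

separated : ∀ {m} {ad : Adj m} {a b c} → ad c a ≡ true → ad c b ≡ false → a ≢ b
separated c~a c≁b refl = true-and-false c~a c≁b

adjacent-distinct : ∀ {m} {ad : Adj m} → Irrefl ad → ∀ {a b} → ad a b ≡ true → a ≢ b
adjacent-distinct irr {a} a~b refl = true-and-false a~b (irr a)

pattern4 : (e₀₁ e₀₂ e₀₃ e₁₂ e₁₃ e₂₃ : Bool) → Pattern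
pattern4 e₀₁ e₀₂ e₀₃ e₁₂ e₁₃ e₂₃ = λ where
  0F 1F → e₀₁ ; 1F 0F → e₀₁ ; 0F 2F → e₀₂ ; 2F 0F → e₀₂ ; 0F 3F → e₀₃ ; 3F 0F → e₀₃
  1F 2F → e₁₂ ; 2F 1F → e₁₂ ; 1F 3F → e₁₃ ; 3F 1F → e₁₃ ; 2F 3F → e₂₃ ; 3F 2F → e₂₃
  _ _ → false

quadruple : ∀ {A : Set} → A → A → A → A → Fin 4 → A
quadruple a b c d = lookup (a ∷ b ∷ c ∷ d ∷ [])

on-pairs : (Q : Fin 4 → Fin 4 → Set) → (∀ a → Q a a) → (∀ {a b} → Q a b → Q b a) →
  Q 0F 1F → Q 0F 2F → Q 0F 3F → Q 1F 2F → Q 1F 3F → Q 2F 3F → ∀ a b → Q a b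
on-pairs Q diag swap q₀₁ q₀₂ q₀₃ q₁₂ q₁₃ q₂₃ = λ where
  0F 1F → q₀₁ ; 1F 0F → swap q₀₁ ; 0F 2F → q₀₂ ; 2F 0F → swap q₀₂ ; 0F 3F → q₀₃ ; 3F 0F → swap q₀₃
  1F 2F → q₁₂ ; 2F 1F → swap q₁₂ ; 1F 3F → q₁₃ ; 3F 1F → swap q₁₃ ; 2F 3F → q₂₃ ; 3F 2F → swap q₂₃
  0F 0F → diag 0F ; 1F 1F → diag 1F ; 2F 2F → diag 2F ; 3F 3F → diag 3F

quadruple-induced : ∀ {m} {ad : Adj m} → Sym ad → Irrefl ad →
  ∀ {e₀₁ e₀₂ e₀₃ e₁₂ e₁₃ e₂₃} (v₀ v₁ v₂ v₃ : Fin m) →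
  v₀ ≢ v₁ → v₀ ≢ v₂ → v₀ ≢ v₃ → v₁ ≢ v₂ → v₁ ≢ v₃ → v₂ ≢ v₃ →
  ad v₀ v₁ ≡ e₀₁ → ad v₀ v₂ ≡ e₀₂ → ad v₀ v₃ ≡ e₀₃ → ad v₁ v₂ ≡ e₁₂ → ad v₁ v₃ ≡ e₁₃ → ad v₂ v₃ ≡ e₂₃ →
  Induced ad (pattern4 e₀₁ e₀₂ e₀₃ e₁₂ e₁₃ e₂₃)
quadruple-induced {ad = ad} sy irr {e₀₁} {e₀₂} {e₀₃} {e₁₂} {e₁₃} {e₂₃} v₀ v₁ v₂ v₃ d₀₁ d₀₂ d₀₃ d₁₂ d₁₃ d₂₃ a₀₁ a₀₂ a₀₃ a₁₂ a₁₃ a₂₃ =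
  g ,
  on-pairs (λ a b → g a ≡ g b → a ≡ b) (λ _ _ → refl) (λ q e → sym (q (sym e)))
    (⊥-elim ∘′ d₀₁) (⊥-elim ∘′ d₀₂) (⊥-elim ∘′ d₀₃) (⊥-elim ∘′ d₁₂) (⊥-elim ∘′ d₁₃) (⊥-elim ∘′ d₂₃) ,
  on-pairs (λ a b → ad (g a) (g b) ≡ F a b) (λ a → trans (irr (g a)) (F-irrefl a))
    (λ {a} {b} q → trans (sy (g b) (g a)) (trans q (F-sym a b))) a₀₁ a₀₂ a₀₃ a₁₂ a₁₃ a₂₃
  where
  g = quadruple v₀ v₁ v₂ v₃
  F = pattern4 e₀₁ e₀₂ e₀₃ e₁₂ e₁₃ e₂₃
  F-sym : ∀ a b → F a b ≡ F b a
  F-sym = on-pairs (λ a b → F a b ≡ F b a) (λ _ → refl) sym refl refl refl refl refl refl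
  F-irrefl : ∀ a → false ≡ F a a
  F-irrefl 0F = refl
  F-irrefl 1F = refl
  F-irrefl 2F = refl
  F-irrefl 3F = refl

Renumbers : (Fin 4 → Fin 4) → Pattern → Pattern → Set
Renumbers π F F′ = (∀ a b → π a ≡ π b → a ≡ b) × (∀ a b → F (π a) (π b) ≡ F′ a b)

renumbers? : ∀ π F F′ → Dec (Renumbers π F F′)
renumbers? π F F′ =
  (all? λ a → all? λ b → (π a ≟ π b) →-dec (a ≟ b)) ×-dec
  (all? λ a → all? λ b → F (π a) (π b) Boolₚ.≟ F′ a b)

relabel : ∀ {m} {ad : Adj m} {π F F′} → Renumbers π F F′ → Induced ad F → Induced ad F′
relabel {π = π} (π-injective , π-renumbers) (g , g-injective , g-induces) =
  g ∘′ π , (λ a b e → π-injective a b (g-injective (π a) (π b) e)) , (λ a b → trans (g-induces (π a) (π b)) (π-renumbers a b))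

renumber : ∀ {m} {ad : Adj m} π F F′ → {True (renumbers? π F F′)} → Induced ad F → Induced ad F′
renumber {ad = ad} π F F′ {ok} = relabel {ad = ad} {π} {F} {F′} (toWitness {a? = renumbers? π F F′} ok)

-- The pattern on (u, v, x, y) where x ~ v, x ≁ u, y ~ u, y ≁ v, with uv = e and xy = f.
crossed : Bool → Bool → Pattern
crossed e f = pattern4 e false true true false f

-- Whatever e and f are, the crossed pattern is a C₄, a P₄ or a 2K₂.
crossed-not-threshold : ∀ {m} {ad : Adj m} → Threshold ad → ∀ e f → ¬ Induced ad (crossed e f)
crossed-not-threshold {ad = ad} (_ , no-C4 , _) true true =
  no-C4 ∘′ renumber {ad = ad} (quadruple 0F 1F 2F 3F) (crossed true true) C4
crossed-not-threshold {ad = ad} (_ , _ , no-P4) true false =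
  no-P4 ∘′ renumber {ad = ad} (quadruple 3F 0F 1F 2F) (crossed true false) P4
crossed-not-threshold {ad = ad} (_ , _ , no-P4) false true =
  no-P4 ∘′ renumber {ad = ad} (quadruple 0F 3F 2F 1F) (crossed false true) P4
crossed-not-threshold {ad = ad} (no-2K2 , _ , _) false false =
  no-2K2 ∘′ renumber {ad = ad} (quadruple 0F 3F 1F 2F) (crossed false false) twoK2

NoUniformVertex : Pattern → Set
NoUniformVertex F = ∀ a → (∃ λ b → b ≢ a × F a b ≡ true) × (∃ λ b → b ≢ a × F a b ≡ false)

no-uniform-vertex? : ∀ F → Dec (NoUniformVertex F)
no-uniform-vertex? F = all? λ a →
  (any? λ b → ¬? (b ≟ a) ×-dec F a b Boolₚ.≟ true) ×-dec (any? λ b → ¬? (b ≟ a) ×-dec F a b Boolₚ.≟ false)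

UniformQuadruples : ∀ {m} → Adj m → Set
UniformQuadruples {m} ad = ∀ (g : Fin 4 → Fin m) → (∀ a b → g a ≡ g b → a ≡ b) →
  Σ (Fin 4) λ a → Σ Bool λ c → ∀ b → b ≢ a → ad (g a) (g b) ≡ c

uniform-excludes : ∀ {m} {ad : Adj m} → UniformQuadruples ad → ∀ F → {True (no-uniform-vertex? F)} → ¬ Induced ad F
uniform-excludes uniform F {mixed} (g , g-injective , g-induces) with uniform g g-injective
... | a , c , a-uniform with toWitness {a? = no-uniform-vertex? F} mixed a
...   | (b , b≢a , Fab) , (b′ , b′≢a , Fab′) =
  true-and-false (trans (sym (a-uniform b b≢a)) (trans (g-induces a b) Fab))
                 (trans (sym (a-uniform b′ b′≢a)) (trans (g-induces a b′) Fab′))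

uniform-quadruples⇒threshold : ∀ {m} {ad : Adj m} → UniformQuadruples ad → Threshold ad
uniform-quadruples⇒threshold {ad = ad} uniform =
  uniform-excludes {ad = ad} uniform twoK2 ,
  uniform-excludes {ad = ad} uniform C4 ,
  uniform-excludes {ad = ad} uniform P4

Uniform : ∀ {m} → Adj m → Bool → Fin m → Set
Uniform ad c v = ∀ z → z ≢ v → ad v z ≡ c

Vicinal : ∀ {m} → Adj m → Fin m → Fin m → Set
Vicinal ad u v = ∀ x → x ≢ u → ad x v ≡ true → ad x u ≡ true

-- The vicinal relation is transitive (the case x = v goes through w's adjacency to u).
vicinal-trans : ∀ {m} {ad : Adj m} → Sym ad → ∀ {u v w} → Vicinal ad u v → Vicinal ad v w → Vicinal ad u w
vicinal-trans {ad = ad} sy {u} {v} {w} u≥v v≥w x x≢u x~w with x ≟ v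
... | no x≢v = u≥v x x≢u (v≥w x x≢v x~w)
... | yes refl with w ≟ u
...   | yes refl = x~w
...   | no w≢u = trans (sy x u) (v≥w u (λ u≡x → x≢u (sym u≡x)) (trans (sy u w) (u≥v w w≢u (trans (sy w x) x~w))))

-- In a graph without induced 2K₂, C₄, P₄ the vicinal preorder is total:
-- otherwise x ∈ N(v) ∖ N[u] and y ∈ N(u) ∖ N[v] span a crossed pattern.
vicinal-total : ∀ {m} {ad : Adj m} → Sym ad → Irrefl ad → Threshold ad → ∀ u v → Vicinal ad u v ⊎ Vicinal ad v u
vicinal-total {ad = ad} sy irr thr u v
  with any? (λ x → ¬? (x ≟ u) ×-dec ad x v Boolₚ.≟ true ×-dec ad x u Boolₚ.≟ false)
... | no none = inj₁ λ x x≢u x~v → Boolₚ.¬-not λ x≁u → none (x , x≢u , x~v , x≁u)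
... | yes (x , x≢u , x~v , x≁u)
  with any? (λ y → ¬? (y ≟ v) ×-dec ad y u Boolₚ.≟ true ×-dec ad y v Boolₚ.≟ false)
...   | no none = inj₂ λ y y≢v y~u → Boolₚ.¬-not λ y≁v → none (y , y≢v , y~u , y≁v)
...   | yes (y , y≢v , y~u , y≁v) = ⊥-elim (crossed-not-threshold {ad = ad} thr (ad u v) (ad x y)
          (quadruple-induced sy irr u v x y
            (λ u≡v → separated {ad = ad} x~v x≁u (sym u≡v)) (λ u≡x → x≢u (sym u≡x))
            (λ u≡y → adjacent-distinct irr y~u (sym u≡y)) (λ v≡x → adjacent-distinct irr x~v (sym v≡x))
            (λ v≡y → y≢v (sym v≡y)) (separated {ad = ad} (trans (sy v x) x~v) (trans (sy v y) y≁v))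
            refl (trans (sy u x) x≁u) (trans (sy u y) y~u) (trans (sy v x) x~v) (trans (sy v y) y≁v) refl))

-- A top a of the vicinal preorder (N(b) ∖ {a} ⊆ N(a) for all b) is dominating,
-- or else each of its non-neighbours w is isolated: a neighbour of w would put w in N(a).
threshold-uniform-vertex : ∀ {m} {ad : Adj (suc m)} → Sym ad → Irrefl ad → Threshold ad →
  Σ (Fin (suc m)) λ v → Σ Bool λ c → Uniform ad c v
threshold-uniform-vertex {ad = ad} sy irr thr
  with least-element (Vicinal ad) (vicinal-total sy irr thr) (vicinal-trans sy)
... | a , a-top with any? (λ w → ¬? (w ≟ a) ×-dec ad a w Boolₚ.≟ false)
...   | no none = a , true , λ z z≢a → Boolₚ.¬-not λ a≁z → none (z , z≢a , a≁z)
...   | yes (w , w≢a , a≁w) = w , false , λ z z≢w → Boolₚ.¬-not λ w~z →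
          true-and-false (a-top z w w≢a w~z) (trans (sy w a) a≁w)

induced-restrict : ∀ {m m′} {ad : Adj m} (h : Fin m′ → Fin m) → (∀ x y → h x ≡ h y → x ≡ y) →
  ∀ {F} → Induced (λ x y → ad (h x) (h y)) F → Induced ad F
induced-restrict h h-injective (g , g-injective , g-induces) =
  h ∘′ g , (λ a b e → g-injective a b (h-injective _ _ e)) , g-induces

threshold-delete : ∀ {m} {ad : Adj (suc m)} v → Threshold ad → Threshold (delete ad v)
threshold-delete {ad = ad} v (no-2K2 , no-C4 , no-P4) =
  no-2K2 ∘′ restrict , no-C4 ∘′ restrict , no-P4 ∘′ restrict
  where
  restrict : ∀ {F} → Induced (delete ad v) F → Induced ad F
  restrict = induced-restrict {ad = ad} (punchIn v) (punchIn-injective v)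

difference-delete : ∀ {m} {ad : Adj (suc m)} {side} v → DifferenceBy ad side → DifferenceBy (delete ad v) (side ∘′ punchIn v)
difference-delete v (independent , nested-B , nested-A) =
  (λ x y → independent (punchIn v x) (punchIn v y)) ,
  (λ b b′ sb sb′ → Sum.map (λ sub a → sub (punchIn v a)) (λ sub a → sub (punchIn v a)) (nested-B _ _ sb sb′)) ,
  (λ a a′ sa sa′ → Sum.map (λ sub b → sub (punchIn v b)) (λ sub b → sub (punchIn v b)) (nested-A _ _ sa sa′))

-- v ∈ A is adjacent to all of B, or v ∈ B is adjacent to none of A; either
-- way v's adjacencies are determined by the sides alone.
Peelable : ∀ {m} → Adj m → (Fin m → Bool) → Fin m → Set
Peelable ad side v =
  (side v ≡ true × ∀ b → side b ≡ false → ad v b ≡ true) ⊎ (side v ≡ false × ∀ a → side a ≡ true → ad v a ≡ false)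

Covers : ∀ {m} → Adj m → (Fin m → Bool) → Fin m → Fin m → Set
Covers ad side u v = side v ≡ true → side u ≡ true × (∀ b → side b ≡ false → ad v b ≡ true → ad u b ≡ true)

-- Totality is the nestedness of the A-neighbourhoods; vertices of B are covered by all.
covers-total : ∀ {m} {ad : Adj m} {side} → DifferenceBy ad side → ∀ u v → Covers ad side u v ⊎ Covers ad side v u
covers-total {side = side} (_ , _ , nested-A) u v with side u in su | side v in sv
... | _ | false = inj₁ λ ()
... | false | true = inj₂ λ ()
... | true | true with nested-A u v su sv
...   | inj₁ u⊆v = inj₂ λ _ → refl , u⊆v
...   | inj₂ v⊆u = inj₁ λ _ → refl , v⊆u

covers-trans : ∀ {m} {ad : Adj m} {side u v w} → Covers ad side u v → Covers ad side v w → Covers ad side u w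
covers-trans u≥v v≥w sw with v≥w sw
... | sv , w⊆v with u≥v sv
...   | su , v⊆u = su , λ b sb w~b → v⊆u b sb (w⊆v b sb w~b)

-- A vertex covering all others is peelable, or else it lies in A and any
-- b ∈ B outside its neighbourhood is adjacent to none of A.
difference-peelable-vertex : ∀ {m} {ad : Adj (suc m)} {side} → Sym ad → DifferenceBy ad side →
  Σ (Fin (suc m)) (Peelable ad side)
difference-peelable-vertex {ad = ad} {side} sy d
  with least-element (Covers ad side) (covers-total d) covers-trans
... | a , a-top with side a in sa
...   | false = a , inj₂ (sa , λ z sz → ⊥-elim (true-and-false (proj₁ (a-top z sz)) refl))
...   | true with any? (λ b → side b Boolₚ.≟ false ×-dec ad a b Boolₚ.≟ false)
...     | no none = a , inj₁ (sa , λ b sb → Boolₚ.¬-not λ a≁b → none (b , sb , a≁b))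
...     | yes (b , sb , a≁b) = b , inj₂ (sb , λ z sz → Boolₚ.¬-not λ b~z →
            true-and-false (proj₂ (a-top z sz) b sb (trans (sy z b) b~z)) a≁b)

peelable-row : ∀ {m} {ad : Adj m} {side v} → DifferenceBy ad side → Peelable ad side v →
  ∀ z → ad v z ≡ side v ∧ not (side z)
peelable-row {side = side} {v} (independent , _) peel z with side z in sz | peel
... | true  | inj₁ (sv , _)      = trans (independent v z (trans sv (sym sz))) (cong (_∧ false) (sym sv))
... | false | inj₁ (sv , v~B)    = trans (v~B z sz) (cong (_∧ true) (sym sv))
... | true  | inj₂ (sv , v≁A)    = trans (v≁A z sz) (cong (_∧ false) (sym sv))
... | false | inj₂ (sv , _)      = trans (independent v z (trans sv (sym sz))) (cong (_∧ true) (sym sv))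

padj-ordered : ∀ {k} (H : Digraph k) is {x y} → toℕ x < toℕ y →
  padj (composeAll H is) x y ≡ H (part (composeAll H is) x) (part (composeAll H is) y)
padj-ordered H (i ∷ is) {zero} {suc y} _ = refl
padj-ordered H (i ∷ is) {suc x} {suc y} (s≤s x<y) = padj-ordered H is x<y

-- An adjacency-preserving bijection from the vertices of P onto those of ad;
-- Realisable H (n G) (adj G) is definitionally IsHThreshold H G.
Realisation : ∀ {k} → PGraph k → (m : ℕ) → Adj m → Set
Realisation P m ad = Σ (Fin (size P) ↔ Fin m) λ f → ∀ x y → ad (Inverse.to f x) (Inverse.to f y) ≡ padj P x y

Realisable : ∀ {k} → Digraph k → (m : ℕ) → Adj m → Set
Realisable H m ad = Σ (List _) λ is → Realisation (composeAll H is) m ad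

realise-cons : ∀ {k m} {H : Digraph k} {ad : Adj (suc m)} {is} → Sym ad → Irrefl ad →
  (v : Fin (suc m)) (l : Fin k) (r : Realisation (composeAll H is) m (delete ad v)) →
  (∀ y → ad v (punchIn v (Inverse.to (proj₁ r) y)) ≡ H l (part (composeAll H is) y)) →
  Realisation (composeAll H (l ∷ is)) (suc m) ad
realise-cons sy irr v l (f , f-realises) row = insert zero v f , λ where
  zero zero → irr v
  zero (suc y) → row y
  (suc x) zero → trans (sy _ v) (row x)
  (suc x) (suc y) → f-realises x y

LabelledRealisation : ∀ {k} → Digraph k → (m : ℕ) → Adj m → (Fin m → Fin k) → Set
LabelledRealisation H m ad lab = Σ (List _) λ is → Σ (Realisation (composeAll H is) m ad) λ r →
  ∀ x → part (composeAll H is) x ≡ lab (Inverse.to (proj₁ r) x)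

realise-by-peeling : ∀ {k} (H : Digraph k) (Inv : ∀ {m} → Adj m → (Fin m → Fin k) → Set) →
  (∀ {m ad lab} v → Inv {suc m} ad lab → Inv (delete ad v) (lab ∘′ punchIn v)) →
  (∀ {m ad lab} → Sym ad → Inv {suc m} ad lab → Σ (Fin (suc m)) λ v → ∀ z → z ≢ v → ad v z ≡ H (lab v) (lab z)) →
  ∀ {m} (ad : Adj m) lab → Sym ad → Irrefl ad → Inv ad lab → LabelledRealisation H m ad lab
realise-by-peeling H Inv inv-delete first {zero} ad lab sy irr inv = [] , (↔-id _ , λ ()) , λ ()
realise-by-peeling H Inv inv-delete first {suc m} ad lab sy irr inv with first sy inv
... | v , v-row with realise-by-peeling H Inv inv-delete first (delete ad v) (lab ∘′ punchIn v)
                       (λ x y → sy (punchIn v x) (punchIn v y)) (λ x → irr (punchIn v x)) (inv-delete v inv)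
...   | is , r , r-labels =
  lab v ∷ is ,
  realise-cons {H = H} {ad = ad} {is = is} sy irr v (lab v) r (λ y → trans (v-row _ (punchInᵢ≢i v _)) (cong (H (lab v)) (sym (r-labels y)))) ,
  λ { zero → refl ; (suc x) → r-labels x }

-- The two labels: 0 marks the side A (or a dominating vertex), 1 the side B.
inA : Fin 2 → Bool
inA 0F = true
inA 1F = false

labelOf : Bool → Fin 2
labelOf true = 0F
labelOf false = 1F

inA-labelOf : ∀ c → inA (labelOf c) ≡ c
inA-labelOf true = refl
inA-labelOf false = refl

inA-injective : ∀ {l l′} → inA l ≡ inA l′ → l ≡ l′
inA-injective {0F} {0F} _ = refl
inA-injective {1F} {1F} _ = refl
inA-injective {0F} {1F} ()
inA-injective {1F} {0F} ()

inA-true : ∀ {l} → inA l ≡ true → l ≡ 0F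
inA-true {0F} _ = refl
inA-true {1F} ()

inA-false : ∀ {l} → inA l ≡ false → l ≡ 1F
inA-false {1F} _ = refl
inA-false {0F} ()

-- H_T: arcs 0→0 and 0→1.  A 0-vertex is adjacent to all later vertices, a 1-vertex to none.
HT : Digraph 2
HT l _ = inA l

-- H_D: the single arc 0→1.  Later B-vertices are joined to earlier A-vertices only.
HD : Digraph 2
HD l j = inA l ∧ not (inA j)

-- Threshold graphs are H_T-threshold: peel off a dominating or isolated vertex.
threshold-realisable : ∀ {m} (ad : Adj m) → Sym ad → Irrefl ad → Threshold ad → Realisable HT m ad
threshold-realisable {zero} ad sy irr thr = [] , ↔-id _ , λ ()
threshold-realisable {suc m} ad sy irr thr with threshold-uniform-vertex sy irr thr
... | v , c , v-uniform with threshold-realisable (delete ad v) (λ x y → sy (punchIn v x) (punchIn v y))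
                               (λ x → irr (punchIn v x)) (threshold-delete {ad = ad} v thr)
...   | is , r = labelOf c ∷ is ,
  realise-cons {ad = ad} {is = is} sy irr v (labelOf c) r (λ y → trans (v-uniform _ (punchInᵢ≢i v _)) (sym (inA-labelOf c)))

SideLabelling : ∀ {m} → Adj m → (Fin m → Fin 2) → Set
SideLabelling ad lab = Σ _ λ side → DifferenceBy ad side × (∀ z → inA (lab z) ≡ side z)

-- Difference graphs are H_D-threshold: peel off a peelable vertex, labelled by its side.
difference-realisable : ∀ {m} (ad : Adj m) → Sym ad → Irrefl ad → Difference ad → Realisable HD m ad
difference-realisable ad sy irr (side , d) =
  proj₁ realised , proj₁ (proj₂ realised)
  where
  side-delete : ∀ {m ad lab} v → SideLabelling {suc m} ad lab → SideLabelling (delete ad v) (lab ∘′ punchIn v)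
  side-delete v (side , d , lab-side) = side ∘′ punchIn v , difference-delete v d , λ z → lab-side (punchIn v z)
  first : ∀ {m ad lab} → Sym ad → SideLabelling {suc m} ad lab →
    Σ (Fin (suc m)) λ v → ∀ z → z ≢ v → ad v z ≡ HD (lab v) (lab z)
  first sy (side , d , lab-side) with difference-peelable-vertex sy d
  ... | v , v-peelable = v , λ z _ →
    trans (peelable-row d v-peelable z) (sym (cong₂ (λ s t → s ∧ not t) (lab-side v) (lab-side z)))
  realised = realise-by-peeling HD SideLabelling side-delete first ad (labelOf ∘′ side) sy irr
               (side , d , λ z → inA-labelOf (side z))

record Layout {m k} (ad : Adj m) (H : Digraph k) (lab : Fin m → Fin k) : Set where
  field
    pos : Fin m → ℕ
    pos-injective : ∀ {u v} → pos u ≡ pos v → u ≡ v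
    ordered : ∀ {u v} → pos u < pos v → ad u v ≡ H (lab u) (lab v)

  adjacency : Sym ad → ∀ {u v} → u ≢ v →
    (pos u < pos v × ad u v ≡ H (lab u) (lab v)) ⊎ (pos v < pos u × ad u v ≡ H (lab v) (lab u))
  adjacency sy {u} {v} u≢v with <-cmp (pos u) (pos v)
  ... | tri< u<v _ _ = inj₁ (u<v , ordered u<v)
  ... | tri≈ _ u≡v _ = ⊥-elim (u≢v (pos-injective u≡v))
  ... | tri> _ _ v<u = inj₂ (v<u , trans (sy u v) (ordered v<u))

  strictly-first : ∀ {u v} → pos u ≤ pos v → v ≢ u → pos u < pos v
  strictly-first u≤v v≢u = ≤∧≢⇒< u≤v (λ e → v≢u (sym (pos-injective e)))
open Layout

realisation-layout : ∀ {k m} {H : Digraph k} {ad : Adj m} → Realisable H m ad → ∃ (Layout ad H)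
realisation-layout {H = H} {ad} (is , f , f-realises) = (λ u → part P (from u)) , record
  { pos = λ u → toℕ (from u)
  ; pos-injective = λ {u} {v} e → begin
      u               ≡⟨ sym (to-from u) ⟩
      to (from u)     ≡⟨ cong to (toℕ-injective e) ⟩
      to (from v)     ≡⟨ to-from v ⟩
      v               ∎
  ; ordered = λ {u} {v} u<v → begin
      ad u v                      ≡⟨ cong₂ ad (sym (to-from u)) (sym (to-from v)) ⟩
      ad (to (from u)) (to (from v)) ≡⟨ f-realises (from u) (from v) ⟩
      padj P (from u) (from v)    ≡⟨ padj-ordered H is u<v ⟩
      H (part P (from u)) (part P (from v)) ∎
  }
  where
  open Inverse f
  open ≡-Reasoning
  P = composeAll H is
  to-from : ∀ u → to (from u) ≡ u
  to-from = strictlyInverseˡ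

layout-delete : ∀ {k m} {H : Digraph k} {ad : Adj (suc m)} {lab} v → Layout ad H lab → Layout (delete ad v) H (lab ∘′ punchIn v)
layout-delete v L = record
  { pos = pos L ∘′ punchIn v
  ; pos-injective = λ e → punchIn-injective v _ _ (pos-injective L e)
  ; ordered = ordered L
  }

-- Conversely a layout is realised, peeling vertices in order of rank.
layout-realisable : ∀ {k m} {H : Digraph k} {ad : Adj m} {lab} → Sym ad → Irrefl ad → Layout ad H lab → Realisable H m ad
layout-realisable {H = H} {ad} {lab} sy irr L =
  proj₁ realised , proj₁ (proj₂ realised)
  where
  first : ∀ {m ad lab} → Sym ad → Layout {suc m} ad H lab →
    Σ (Fin (suc m)) λ v → ∀ z → z ≢ v → ad v z ≡ H (lab v) (lab z)
  first _ L with least-element (λ u v → pos L u ≤ pos L v) (λ u v → ≤-total (pos L u) (pos L v)) ≤-trans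
  ... | v , v-least = v , λ z z≢v → ordered L (strictly-first L (v-least z) z≢v)
  realised = realise-by-peeling H (λ ad lab → Layout ad H lab) layout-delete first ad lab sy irr L

negate : ∀ {k} → Digraph k → Digraph k
negate H i j = not (H i j)

layout-negate : ∀ {k m} {H : Digraph k} {ad ad′ : Adj m} {lab} → (∀ x y → x ≢ y → ad′ x y ≡ not (ad x y)) →
  Layout ad H lab → Layout ad′ (negate H) lab
layout-negate flips L = record
  { pos = pos L
  ; pos-injective = pos-injective L
  ; ordered = λ u<v → trans (flips _ _ (λ u≡v → <-irrefl (cong (pos L) u≡v) u<v)) (cong not (ordered L u<v))
  }

layout-relabel : ∀ {k k′ m} {H : Digraph k} {ad : Adj m} {lab} (σ : Fin k → Fin k′) (τ : Fin k′ → Fin k) →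
  (∀ l → τ (σ l) ≡ l) → Layout ad H lab → Layout ad (λ i j → H (τ i) (τ j)) (σ ∘′ lab)
layout-relabel {H = H} σ τ τσ L = record
  { pos = pos L
  ; pos-injective = pos-injective L
  ; ordered = λ u<v → trans (ordered L u<v) (sym (cong₂ H (τσ _) (τσ _)))
  }

layout-swap : ∀ {m} {H : Digraph 2} {ad : Adj m} {lab} → Layout ad H lab →
  Layout ad (λ i j → H (opposite i) (opposite j)) (opposite ∘′ lab)
layout-swap = layout-relabel opposite opposite opposite-involutive

two-labels : ∀ {k m} {H : Digraph k} {ad : Adj m} {lab} → k ≤ 2 → Layout ad H lab →
  Σ (Digraph 2) λ H′ → ∃ (Layout ad H′)
two-labels {zero} {lab = lab} _ L = (λ _ _ → false) , (λ u → ⊥-elim (¬Fin0 (lab u))) , record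
  { pos = pos L ; pos-injective = pos-injective L ; ordered = λ {u} _ → ⊥-elim (¬Fin0 (lab u)) }
two-labels {suc zero} _ L = _ , _ , layout-relabel (λ _ → 0F) (λ _ → zero) (λ { zero → refl ; (suc ()) }) L
two-labels {suc (suc zero)} _ L = _ , _ , L
two-labels {suc (suc (suc _))} (s≤s (s≤s ())) L

same-label-adjacency : ∀ {k m} {H : Digraph k} {ad : Adj m} {lab} → Sym ad → Layout ad H lab →
  ∀ {x y} → x ≢ y → lab x ≡ lab y → ad x y ≡ H (lab x) (lab x)
same-label-adjacency {H = H} {lab = lab} sy L {x} {y} x≢y same with adjacency L sy x≢y
... | inj₁ (_ , e) = trans e (cong (H (lab x)) (sym same))
... | inj₂ (_ , e) = trans e (cong (λ l → H l (lab x)) (sym same))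

other-label : ∀ {u l l′ : Fin 2} → l ≢ u → l′ ≢ u → l ≡ l′
other-label {0F} {0F} l≢u _ = ⊥-elim (l≢u refl)
other-label {0F} {1F} {0F} _ l′≢u = ⊥-elim (l′≢u refl)
other-label {0F} {1F} {1F} _ _ = refl
other-label {1F} {1F} l≢u _ = ⊥-elim (l≢u refl)
other-label {1F} {0F} {1F} _ l′≢u = ⊥-elim (l′≢u refl)
other-label {1F} {0F} {0F} _ _ = refl

-- If the rows of H are constant, the earliest of four vertices is uniform among them.
earliest-uniform : ∀ {m} {H : Digraph 2} {ad : Adj m} {lab} → Layout ad H lab →
  (∀ l j → H l j ≡ H l l) → UniformQuadruples ad
earliest-uniform {H = H} {lab = lab} L rows g g-injective
  with least-element (λ a b → pos L (g a) ≤ pos L (g b)) (λ a b → ≤-total _ _) ≤-trans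
... | a , a-first = a , H (lab (g a)) (lab (g a)) , λ b b≢a →
  trans (ordered L (strictly-first L (a-first b) (λ e → b≢a (g-injective b a e)))) (rows _ _)

-- If the columns of H are constant, the latest of four vertices is uniform among them.
latest-uniform : ∀ {m} {H : Digraph 2} {ad : Adj m} {lab} → Sym ad → Layout ad H lab →
  (∀ l j → H l j ≡ H j j) → UniformQuadruples ad
latest-uniform {H = H} {lab = lab} sy L columns g g-injective
  with least-element (λ a b → pos L (g b) ≤ pos L (g a)) (λ a b → ≤-total _ _) (λ a≥b b≥c → ≤-trans b≥c a≥b)
... | a , a-last = a , H (lab (g a)) (lab (g a)) , λ b b≢a →
  trans (sy (g a) (g b)) (trans (ordered L (strictly-first L (a-last b) (λ e → b≢a (sym (g-injective a b e))))) (columns _ _))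

-- If row u and column u of H are constant c, a u-labelled vertex is uniform;
-- without one, all four vertices carry the other label and any of them is uniform.
label-uniform : ∀ {m} {H : Digraph 2} {ad : Adj m} {lab} → Sym ad → Layout ad H lab →
  (u : Fin 2) (c : Bool) → (∀ j → H u j ≡ c) → (∀ j → H j u ≡ c) → UniformQuadruples ad
label-uniform {H = H} {lab = lab} sy L u c row column g g-injective with any? (λ a → lab (g a) ≟ u)
... | yes (a , a-at-u) = a , c , λ b b≢a → [ (λ { (_ , e) → trans e (trans (cong (λ l → H l (lab (g b))) a-at-u) (row _)) })
                                           , (λ { (_ , e) → trans e (trans (cong (H (lab (g b))) a-at-u) (column _)) }) ]′
                                           (adjacency L sy (λ e → b≢a (g-injective b a (sym e))))
... | no none = 0F , H (lab (g 0F)) (lab (g 0F)) , λ b b≢0 →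
  same-label-adjacency sy L (λ e → b≢0 (g-injective b 0F (sym e)))
    (other-label (λ e → none (0F , e)) (λ e → none (b , e)))

rank-difference : ∀ {m} {ad : Adj m} → Sym ad → (side : Fin m → Bool) (ρ : Fin m → ℕ) →
  (∀ x y → side x ≡ side y → ad x y ≡ false) →
  (∀ a b → side a ≡ true → side b ≡ false → ad a b ≡ true ⇔ ρ a < ρ b) →
  Difference ad
rank-difference {ad = ad} sy side ρ independent cross = side , independent , nested-B , nested-A
  where
  below : ∀ {a b} → side a ≡ true → side b ≡ false → ad a b ≡ true → ρ a < ρ b
  below {a} {b} sa sb = Equivalence.to (cross a b sa sb)
  joined : ∀ {a b} → side a ≡ true → side b ≡ false → ρ a < ρ b → ad a b ≡ true
  joined {a} {b} sa sb = Equivalence.from (cross a b sa sb)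
  nested-B : ∀ b b′ → side b ≡ false → side b′ ≡ false → _
  nested-B b b′ sb sb′ with ≤-total (ρ b) (ρ b′)
  ... | inj₁ b≤b′ = inj₁ λ a sa b~a → trans (sy b′ a) (joined sa sb′ (<-≤-trans (below sa sb (trans (sy a b) b~a)) b≤b′))
  ... | inj₂ b′≤b = inj₂ λ a sa b′~a → trans (sy b a) (joined sa sb (<-≤-trans (below sa sb′ (trans (sy a b′) b′~a)) b′≤b))
  nested-A : ∀ a a′ → side a ≡ true → side a′ ≡ true → _
  nested-A a a′ sa sa′ with ≤-total (ρ a) (ρ a′)
  ... | inj₁ a≤a′ = inj₂ λ b sb a′~b → joined sa sb (≤-<-trans a≤a′ (below sa′ sb a′~b))
  ... | inj₂ a′≤a = inj₁ λ b sb a~b → joined sa′ sb (≤-<-trans a′≤a (below sa sb a~b))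

cross-adjacency : ∀ {m} {H : Digraph 2} {ad : Adj m} {lab} → Sym ad → (L : Layout ad H lab) →
  ∀ {a b} → lab a ≡ 0F → lab b ≡ 1F →
  (pos L a < pos L b × ad a b ≡ H 0F 1F) ⊎ (pos L b < pos L a × ad a b ≡ H 1F 0F)
cross-adjacency {H = H} sy L {a} {b} la lb with adjacency L sy (λ { refl → 0≢1 (trans (sym la) lb) })
  where
  0≢1 : 0F ≢ 1F
  0≢1 ()
... | inj₁ (a<b , e) = inj₁ (a<b , trans e (cong₂ H la lb))
... | inj₂ (b<a , e) = inj₂ (b<a , trans e (cong₂ H lb la))

loopless-independent : ∀ {m} {H : Digraph 2} {ad : Adj m} {lab} → Sym ad → Irrefl ad → Layout ad H lab →
  H 0F 0F ≡ false → H 1F 1F ≡ false → ∀ x y → inA (lab x) ≡ inA (lab y) → ad x y ≡ false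
loopless-independent {H = H} {lab = lab} sy irr L h00 h11 x y same-side with x ≟ y
... | yes refl = irr x
... | no x≢y = trans (same-label-adjacency sy L x≢y (inA-injective same-side)) (no-loop (lab x))
  where
  no-loop : ∀ l → H l l ≡ false
  no-loop 0F = h00
  no-loop 1F = h11

-- H = {0→1}: an A-vertex is adjacent exactly to the later B-vertices, so rank by position.
forward-difference : ∀ {m} {H : Digraph 2} {ad : Adj m} {lab} → Sym ad → Irrefl ad → Layout ad H lab →
  H 0F 0F ≡ false → H 1F 1F ≡ false → H 0F 1F ≡ true → H 1F 0F ≡ false → Difference ad
forward-difference {lab = lab} sy irr L h00 h11 h01 h10 =
  rank-difference sy (inA ∘′ lab) (pos L) (loopless-independent sy irr L h00 h11) cross
  where
  cross : ∀ a b → inA (lab a) ≡ true → inA (lab b) ≡ false → _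
  cross a b sa sb with cross-adjacency sy L (inA-true sa) (inA-false sb)
  ... | inj₁ (a<b , e) = mk⇔ (λ _ → a<b) (λ _ → trans e h01)
  ... | inj₂ (b<a , e) = mk⇔ (λ a~b → ⊥-elim (true-and-false a~b (trans e h10))) (λ a<b → ⊥-elim (<-asym a<b b<a))

-- H₀₁ = H₁₀ = c: the graph between the sides is complete (c = true) or empty.
constant-difference : ∀ {m} {H : Digraph 2} {ad : Adj m} {lab} → Sym ad → Irrefl ad → Layout ad H lab →
  H 0F 0F ≡ false → H 1F 1F ≡ false → ∀ c → H 0F 1F ≡ c → H 1F 0F ≡ c → Difference ad
constant-difference {ad = ad} {lab} sy irr L h00 h11 c h01 h10 = rank-difference sy (inA ∘′ lab) ρ
  (loopless-independent sy irr L h00 h11) (λ a b sa sb → cross c (cross-value sa sb) sa sb)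
  where
  cross-value : ∀ {a b} → inA (lab a) ≡ true → inA (lab b) ≡ false → ad a b ≡ c
  cross-value sa sb = [ (λ { (_ , e) → trans e h01 }) , (λ { (_ , e) → trans e h10 }) ]′
                        (cross-adjacency sy L (inA-true sa) (inA-false sb))
  -- A-vertices get rank 0, B-vertices rank 1 if c = true and 0 otherwise.
  ρ : Fin _ → ℕ
  ρ z = if c ∧ not (inA (lab z)) then 1 else 0
  cross : ∀ c′ {a b} → ad a b ≡ c′ → inA (lab a) ≡ true → inA (lab b) ≡ false →
    ad a b ≡ true ⇔ (if c′ ∧ not (inA (lab a)) then 1 else 0) < (if c′ ∧ not (inA (lab b)) then 1 else 0)
  cross true e sa sb rewrite sa | sb = mk⇔ (λ _ → s≤s z≤n) (λ _ → e)
  cross false e _ _ = mk⇔ (λ a~b → ⊥-elim (true-and-false a~b e)) (λ ())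

loopless-difference : ∀ {m} {H : Digraph 2} {ad : Adj m} {lab} → Sym ad → Irrefl ad → Layout ad H lab →
  H 0F 0F ≡ false → H 1F 1F ≡ false → Difference ad
loopless-difference {H = H} sy irr L h00 h11 with H 0F 1F in h01 | H 1F 0F in h10
... | true  | false = forward-difference sy irr L h00 h11 h01 h10
... | false | true  = forward-difference sy irr (layout-swap L) h11 h00 h10 h01
... | true  | true  = constant-difference sy irr L h00 h11 true h01 h10
... | false | false = constant-difference sy irr L h00 h11 false h01 h10

-- H with a loop at 0 only: the four remaining choices of H₀₁, H₁₀ make rows
-- constant, columns constant, label 0 universal, or label 1 null.
one-loop-threshold : ∀ {m} {H : Digraph 2} {ad : Adj m} {lab} → Sym ad → Layout ad H lab →
  H 0F 0F ≡ true → H 1F 1F ≡ false → Threshold ad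
one-loop-threshold {H = H} {ad} sy L h00 h11 with H 0F 1F in h01 | H 1F 0F in h10
... | true | false = uniform-quadruples⇒threshold {ad = ad} (earliest-uniform L λ where
  0F 0F → refl ; 0F 1F → trans h01 (sym h00) ; 1F 0F → trans h10 (sym h11) ; 1F 1F → refl)
... | false | true = uniform-quadruples⇒threshold {ad = ad} (latest-uniform sy L λ where
  0F 0F → refl ; 0F 1F → trans h01 (sym h11) ; 1F 0F → trans h10 (sym h00) ; 1F 1F → refl)
... | true | true = uniform-quadruples⇒threshold {ad = ad}
  (label-uniform sy L 0F true (λ { 0F → h00 ; 1F → h01 }) (λ { 0F → h00 ; 1F → h10 }))
... | false | false = uniform-quadruples⇒threshold {ad = ad}
  (label-uniform sy L 1F false (λ { 0F → h10 ; 1F → h11 }) (λ { 0F → h01 ; 1F → h11 }))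

compl-adj : ∀ G x y → x ≢ y → adj (compl G) x y ≡ not (adj G x y)
compl-adj G x y x≢y with x ≟ y
... | yes x≡y = ⊥-elim (x≢y x≡y)
... | no _ = refl

adj-compl : ∀ G x y → x ≢ y → adj G x y ≡ not (adj (compl G) x y)
adj-compl G x y x≢y = trans (sym (Boolₚ.not-involutive _)) (cong not (sym (compl-adj G x y x≢y)))

complement-realisable : ∀ G {k} {H : Digraph k} → Realisable H (n G) (adj (compl G)) → Realisable (negate H) (n G) (adj G)
complement-realisable G r = layout-realisable (adj-sym G) (adj-irrefl G) (layout-negate (adj-compl G) (proj₂ (realisation-layout r)))

ThresholdOrDifference : Graph → Set
ThresholdOrDifference G = (IsThreshold G ⊎ IsDifference G) ⊎ (IsThreshold (compl G) ⊎ IsDifference (compl G))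

-- Classification of layouts over digraphs on two vertices, by their loops:
-- none (difference), one (threshold, after swapping labels if needed),
-- or two (the complement is loop-free, so the complement is a difference graph).
layout-classification : ∀ G {H : Digraph 2} {lab} → Layout (adj G) H lab → ThresholdOrDifference G
layout-classification G {H} L with H 0F 0F in h00 | H 1F 1F in h11
... | false | false = inj₁ (inj₂ (loopless-difference (adj-sym G) (adj-irrefl G) L h00 h11))
... | true  | false = inj₁ (inj₁ (one-loop-threshold (adj-sym G) L h00 h11))
... | false | true  = inj₁ (inj₁ (one-loop-threshold (adj-sym G) (layout-swap L) h11 h00))
... | true  | true  = inj₂ (inj₂ (loopless-difference (adj-sym (compl G)) (adj-irrefl (compl G))
                        (layout-negate (compl-adj G) L) (cong not h00) (cong not h11)))

proposition5 : (G : Graph) →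
    ThrWidth≤ G 2 ⇔ ((IsThreshold G ⊎ IsDifference G) ⊎ (IsThreshold (compl G) ⊎ IsDifference (compl G)))
proposition5 G = mk⇔ forward backward
  where
  forward : ThrWidth≤ G 2 → ThresholdOrDifference G
  forward (k , k≤2 , H , realisable) with realisation-layout realisable
  ... | _ , L with two-labels k≤2 L
  ...   | _ , _ , L₂ = layout-classification G L₂
  backward : ThresholdOrDifference G → ThrWidth≤ G 2
  backward (inj₁ (inj₁ thr)) = 2 , ≤-refl , HT , threshold-realisable (adj G) (adj-sym G) (adj-irrefl G) thr
  backward (inj₁ (inj₂ dif)) = 2 , ≤-refl , HD , difference-realisable (adj G) (adj-sym G) (adj-irrefl G) dif
  backward (inj₂ (inj₁ thr)) = 2 , ≤-refl , negate HT , complement-realisable G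
    (threshold-realisable (adj (compl G)) (adj-sym (compl G)) (adj-irrefl (compl G)) thr)
  backward (inj₂ (inj₂ dif)) = 2 , ≤-refl , negate HD , complement-realisable G
    (difference-realisable (adj (compl G)) (adj-sym (compl G)) (adj-irrefl (compl G)) dif)
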